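{- Let $p$ be a prime and $e$ a positive divisor of $p-1$. Let $n$ be a fixed positive integer and $H$ a positive integer with $H<p$. Then the number $J$ of pairs of integers $(h,k)\in\{1,2,\ldots,H\}^2$ for which the ratio $h/k$ (computed in $\mathbb{F}_p$) is an $e$-th power residue modulo $p$ satisfies $$J\lesssim H\left(\frac{H}{e^{1/n}}+\frac{p^{1/n}}{e^{1/n}}\right).$$
   Context: An element $u\in\mathbb{F}_p^*$ is an $e$-th power residue if $u=z^e$ for some $z\in\mathbb{F}_p^*$. The notation $A\lesssim B$ means $|A|\leqslant Bp^{o(1)}$ as $p\to\infty$ (the $o(1)$ may depend on $n$, but is uniform in $e$ and $H$). -}

module Defs where

open import Data.Nat using (ℕ; zero; suc; _+_; _*_; _∸_; _^_; _%_; _≡ᵇ_; _⊔_)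
open import Data.Bool using (Bool; true; false; if_then_else_)
open import Data.List using (List; map; upTo)
open import Data.Nat.ListAction using (sum)
open import Data.Bool.ListAction using (any)

range1 : ℕ → List ℕ
range1 H = map suc (upTo H)

count : {A : Set} → (A → Bool) → List A → ℕ
count f xs = sum (map (λ x → if f x then 1 else 0) xs)

-- The ratio h/k, computed in F_p (k a unit mod p), is an e-th power residue:
-- there is z ∈ F_p^* = {1,…,p-1} with h/k = z^e, i.e. h ≡ k · z^e (mod p).
-- (Decided by exhaustive search over z ∈ {1,…,p-1}.)
ratioIsResidue : (p e h k : ℕ) → Bool
ratioIsResidue zero    e h k = false
ratioIsResidue (suc q) e h k =
  any (λ z → ((k * z ^ e) % suc q) ≡ᵇ (h % suc q)) (range1 q)

J : (p e H : ℕ) → ℕ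
J p e H = sum (map (λ h → count (λ k → ratioIsResidue p e h k) (range1 H)) (range1 H))

-- Write χ(a, b) ∈ {0, 1} for "a/b is an e-th power residue mod p". Since χ(h, k) χ(a, b) ≤ χ(ha, kb),
-- Jⁿ is at most the number of pairs of n-tuples in {1, …, H}ⁿ whose products a, b ≤ X = Hⁿ satisfy
-- χ(a, b); grouping tuples by their product costs a factor max τ(b)ⁿ. For fixed a, the admissible b
-- lie in the classes a·g⁻¹ with g an e-th power. By Fermat every such g is a root of xᵗ = 1, where
-- t = (p − 1)/e, so by Lagrange there are at most t classes, each meeting [1, X] in at most X/p + 1
-- points. Hence Jⁿ e ≤ Hⁿ · max τ(b)ⁿ · (p − 1)(X/p + 1) ≤ Hⁿ · max τ(b)ⁿ · 2 max(Hⁿ, p), and the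
-- divisor bound τ(b)ⁿᵐ ≤ C b ≤ C pⁿ finishes the proof after raising to the m-th power.

module Submission where

open import Defs
open import Data.Nat using (ℕ; _*_; _^_; _∸_; _≤_; _<_; _⊔_)
open import Data.Nat.Primality using (Prime)
open import Data.Product using (∃)
open import Data.Nat.Divisibility using (_∣_)

open import Data.Bool using (Bool; true; false; T; if_then_else_; _∧_; not)
open import Data.Bool.ListAction using (any)
open import Data.List using ([]; _∷_; map; applyUpTo)
open import Data.List.Properties using (map-applyUpTo)
open import Data.List.Relation.Unary.All using (_∷_)
open import Data.List.Relation.Unary.Any.Properties using (any⁺; any⁻; applyUpTo⁺; applyUpTo⁻)
open import Data.Nat
open import Data.Nat.Combinatorics
  using (_C_; nCn≡1; k>n⇒nCk≡0; nCk+nC[k+1]≡[n+1]C[k+1]; nCk≡n!/k![n-k]!; k![n∸k]!∣n!)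
open import Data.Nat.Coprimality using (Coprime; gcd≡1⇒coprime; coprime-divisor)
open import Data.Nat.DivMod
open import Data.Nat.Divisibility
open import Data.Nat.GCD using (gcd[m,n]∣m; gcd[m,n]∣n)
open import Data.Nat.Induction using (<-rec)
open import Data.Nat.ListAction using (sum; product)
open import Data.Nat.Primality
open import Data.Nat.Primality.Factorisation using (factorise)
open import Data.Nat.Properties
open import Data.Nat.Tactic.RingSolver using (solve-∀)
open import Data.Product using (_×_; _,_; proj₁; proj₂; ∃₂)
open import Data.Sum using (_⊎_; inj₁; inj₂)
open import Data.Unit using (tt)
open import Function using (_∘_; id)
open import Relation.Binary.PropositionalEquality hiding (J)
open import Relation.Nullary using (¬_; yes; no; contradiction)
open import Relation.Nullary.Decidable using (T?; isYes; toWitness; fromWitness)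

⟦_⟧ : Bool → ℕ
⟦ b ⟧ = if b then 1 else 0

⟦⟧≤1 : ∀ b → ⟦ b ⟧ ≤ 1
⟦⟧≤1 true  = ≤-refl
⟦⟧≤1 false = z≤n

T⇒⟦⟧≡1 : ∀ {b} → T b → ⟦ b ⟧ ≡ 1
T⇒⟦⟧≡1 {true} _ = refl

¬T⇒⟦⟧≡0 : ∀ {b} → ¬ T b → ⟦ b ⟧ ≡ 0
¬T⇒⟦⟧≡0 {true}  ¬t = contradiction tt ¬t
¬T⇒⟦⟧≡0 {false} _  = refl

⟦⟧-mono : ∀ {b c} → (T b → T c) → ⟦ b ⟧ ≤ ⟦ c ⟧
⟦⟧-mono {false} _ = z≤n
⟦⟧-mono {true}  h = ≤-reflexive (sym (T⇒⟦⟧≡1 (h tt)))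

⟦⟧-≤-+ : ∀ {b c d} → (T b → T c ⊎ T d) → ⟦ b ⟧ ≤ ⟦ c ⟧ + ⟦ d ⟧
⟦⟧-≤-+ {false} _ = z≤n
⟦⟧-≤-+ {true} {c} h with h tt
... | inj₁ tc = ≤-trans (≤-reflexive (sym (T⇒⟦⟧≡1 tc))) (m≤m+n _ _)
... | inj₂ td = ≤-trans (≤-reflexive (sym (T⇒⟦⟧≡1 td))) (m≤n+m _ ⟦ c ⟧)

⟦⟧*⟦⟧≤⟦⟧ : ∀ {b c d} → (T b → T c → T d) → ⟦ b ⟧ * ⟦ c ⟧ ≤ ⟦ d ⟧
⟦⟧*⟦⟧≤⟦⟧ {false}         _ = z≤n
⟦⟧*⟦⟧≤⟦⟧ {true} {false}  _ = z≤n
⟦⟧*⟦⟧≤⟦⟧ {true} {true}   h = ≤-reflexive (sym (T⇒⟦⟧≡1 (h tt tt)))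

⟦⟧≤⟦⟧+⟦∧not⟧ : ∀ b c → ⟦ b ⟧ ≤ ⟦ c ⟧ + ⟦ b ∧ not c ⟧
⟦⟧≤⟦⟧+⟦∧not⟧ false c     = z≤n
⟦⟧≤⟦⟧+⟦∧not⟧ true  true  = s≤s z≤n
⟦⟧≤⟦⟧+⟦∧not⟧ true  false = s≤s z≤n

T-∧-not⁻ : ∀ {b c} → T (b ∧ not c) → T b × ¬ T c
T-∧-not⁻ {true} {false} _ = tt , λ ()

∑ : ℕ → (ℕ → ℕ) → ℕ
∑ zero    f = 0
∑ (suc n) f = f 0 + ∑ n (f ∘ suc)

countBelow : ℕ → (ℕ → Bool) → ℕ
countBelow n P = ∑ n (λ k → ⟦ P k ⟧)

∑-cong : ∀ n {f g : ℕ → ℕ} → (∀ {k} → k < n → f k ≡ g k) → ∑ n f ≡ ∑ n g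
∑-cong zero    _ = refl
∑-cong (suc n) h = cong₂ _+_ (h z<s) (∑-cong n (h ∘ s<s))

∑-mono-≤ : ∀ n {f g : ℕ → ℕ} → (∀ {k} → k < n → f k ≤ g k) → ∑ n f ≤ ∑ n g
∑-mono-≤ zero    _ = z≤n
∑-mono-≤ (suc n) h = +-mono-≤ (h z<s) (∑-mono-≤ n (h ∘ s<s))

∑-distrib-+ : ∀ n (f g : ℕ → ℕ) → ∑ n (λ k → f k + g k) ≡ ∑ n f + ∑ n g
∑-distrib-+ zero    f g = refl
∑-distrib-+ (suc n) f g = begin
  f 0 + g 0 + ∑ n (λ k → f (suc k) + g (suc k))
    ≡⟨ cong (f 0 + g 0 +_) (∑-distrib-+ n (f ∘ suc) (g ∘ suc)) ⟩
  f 0 + g 0 + (∑ n (f ∘ suc) + ∑ n (g ∘ suc))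
    ≡⟨ +-interchange (f 0) (g 0) _ _ ⟩
  f 0 + ∑ n (f ∘ suc) + (g 0 + ∑ n (g ∘ suc)) ∎
  where
  open ≡-Reasoning
  +-interchange : ∀ a b c d → a + b + (c + d) ≡ a + c + (b + d)
  +-interchange = solve-∀

*-distribˡ-∑ : ∀ n c (f : ℕ → ℕ) → c * ∑ n f ≡ ∑ n (λ k → c * f k)
*-distribˡ-∑ zero    c f = *-zeroʳ c
*-distribˡ-∑ (suc n) c f =
  trans (*-distribˡ-+ c (f 0) _) (cong (c * f 0 +_) (*-distribˡ-∑ n c (f ∘ suc)))

*-distribʳ-∑ : ∀ n c (f : ℕ → ℕ) → ∑ n f * c ≡ ∑ n (λ k → f k * c)
*-distribʳ-∑ n c f =
  trans (*-comm _ c) (trans (*-distribˡ-∑ n c f) (∑-cong n (λ {k} _ → *-comm c (f k))))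

∑-const : ∀ n c → ∑ n (λ _ → c) ≡ n * c
∑-const zero    c = refl
∑-const (suc n) c = cong (c +_) (∑-const n c)

∑-init-last : ∀ n (f : ℕ → ℕ) → ∑ (suc n) f ≡ ∑ n f + f n
∑-init-last zero    f = +-comm (f 0) 0
∑-init-last (suc n) f =
  trans (cong (f 0 +_) (∑-init-last n (f ∘ suc))) (sym (+-assoc (f 0) _ _))

term≤∑ : ∀ n (f : ℕ → ℕ) {k} → k < n → f k ≤ ∑ n f
term≤∑ (suc n) f {zero} z<s       = m≤m+n (f 0) _
term≤∑ (suc n) f {suc k} (s<s k<n) = ≤-trans (term≤∑ n (f ∘ suc) k<n) (m≤n+m _ (f 0))

term≤∑∘suc : ∀ n (f : ℕ → ℕ) {g} → 0 < g → g ≤ n → f g ≤ ∑ n (f ∘ suc)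
term≤∑∘suc n f {suc k} _ k<n = term≤∑ n (f ∘ suc) k<n

∑-comm : ∀ m n (f : ℕ → ℕ → ℕ) →
  ∑ m (λ i → ∑ n (f i)) ≡ ∑ n (λ j → ∑ m (λ i → f i j))
∑-comm zero    n f = sym (trans (∑-const n 0) (*-zeroʳ n))
∑-comm (suc m) n f = trans (cong (∑ n (f 0) +_) (∑-comm m n (f ∘ suc)))
                           (sym (∑-distrib-+ n (f 0) _))

sum-map-range1 : ∀ n (f : ℕ → ℕ) → sum (map f (range1 n)) ≡ ∑ n (f ∘ suc)
sum-map-range1 n f = begin
  sum (map f (map suc (applyUpTo id n))) ≡⟨ cong (sum ∘ map f) (map-applyUpTo id suc n) ⟩
  sum (map f (applyUpTo suc n))          ≡⟨ cong sum (map-applyUpTo suc f n) ⟩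
  sum (applyUpTo (f ∘ suc) n)            ≡⟨ sum-applyUpTo n (f ∘ suc) ⟩
  ∑ n (f ∘ suc)                          ∎
  where
  open ≡-Reasoning
  sum-applyUpTo : ∀ n g → sum (applyUpTo g n) ≡ ∑ n g
  sum-applyUpTo zero    g = refl
  sum-applyUpTo (suc n) g = cong (g 0 +_) (sum-applyUpTo n (g ∘ suc))

∣-∑ : ∀ {d} n (f : ℕ → ℕ) → (∀ {k} → k < n → d ∣ f k) → d ∣ ∑ n f
∣-∑ zero    f _ = _ ∣0
∣-∑ (suc n) f h = ∣m∣n⇒∣m+n (h z<s) (∣-∑ n (f ∘ suc) (h ∘ s<s))

countBelow-remove : ∀ M (R : ℕ → Bool) {y} → y < M → T (R y) →
  countBelow M (λ k → if k ≡ᵇ y then false else R k) + 1 ≤ countBelow M R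
countBelow-remove M R {y} y<M Ry = begin
  countBelow M R′ + 1                           ≤⟨ +-monoʳ-≤ _ (≤-trans y≡ᵇy (term≤∑ M _ y<M)) ⟩
  countBelow M R′ + countBelow M (_≡ᵇ y)        ≡⟨ ∑-distrib-+ M _ _ ⟨
  ∑ M (λ k → ⟦ R′ k ⟧ + ⟦ k ≡ᵇ y ⟧)             ≡⟨ ∑-cong M (λ {k} _ → split k) ⟩
  countBelow M R                                ∎
  where
  open ≤-Reasoning
  R′ : ℕ → Bool
  R′ k = if k ≡ᵇ y then false else R k
  y≡ᵇy : 1 ≤ ⟦ y ≡ᵇ y ⟧
  y≡ᵇy = ≤-reflexive (sym (T⇒⟦⟧≡1 (≡⇒≡ᵇ y y refl)))
  split : ∀ k → ⟦ R′ k ⟧ + ⟦ k ≡ᵇ y ⟧ ≡ ⟦ R k ⟧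
  split k with k ≡ᵇ y in k≟y
  ... | false = +-identityʳ _
  ... | true  = sym (T⇒⟦⟧≡1 (subst (T ∘ R) (sym (≡ᵇ⇒≡ k y (subst T (sym k≟y) tt))) Ry))

countBelow-≤-injection : ∀ N M (P R : ℕ → Bool) (f : ℕ → ℕ) →
  (∀ {k} → k < N → T (P k) → f k < M × T (R (f k))) →
  (∀ {k k′} → k < N → k′ < N → T (P k) → T (P k′) → f k ≡ f k′ → k ≡ k′) →
  countBelow N P ≤ countBelow M R
countBelow-≤-injection zero    M P R f maps inj = z≤n
countBelow-≤-injection (suc N) M P R f maps inj
  rewrite ∑-init-last N (λ k → ⟦ P k ⟧) with T? (P N)
... | no ¬PN = begin
  countBelow N P + ⟦ P N ⟧ ≡⟨ cong (countBelow N P +_) (¬T⇒⟦⟧≡0 ¬PN) ⟩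
  countBelow N P + 0       ≡⟨ +-identityʳ _ ⟩
  countBelow N P           ≤⟨ countBelow-≤-injection N M P R f (maps ∘ m<n⇒m<1+n) inj′ ⟩
  countBelow M R           ∎
  where
  open ≤-Reasoning
  inj′ : ∀ {k k′} → k < N → k′ < N → T (P k) → T (P k′) → f k ≡ f k′ → k ≡ k′
  inj′ k< k′< = inj (m<n⇒m<1+n k<) (m<n⇒m<1+n k′<)
... | yes PN = begin
  countBelow N P + ⟦ P N ⟧  ≡⟨ cong (countBelow N P +_) (T⇒⟦⟧≡1 PN) ⟩
  countBelow N P + 1        ≤⟨ +-monoˡ-≤ 1 (countBelow-≤-injection N M P R′ f maps′ inj′) ⟩
  countBelow M R′ + 1       ≤⟨ countBelow-remove M R (proj₁ (maps ≤-refl PN)) (proj₂ (maps ≤-refl PN)) ⟩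
  countBelow M R            ∎
  where
  open ≤-Reasoning
  R′ : ℕ → Bool
  R′ k = if k ≡ᵇ f N then false else R k
  inj′ : ∀ {k k′} → k < N → k′ < N → T (P k) → T (P k′) → f k ≡ f k′ → k ≡ k′
  inj′ k< k′< = inj (m<n⇒m<1+n k<) (m<n⇒m<1+n k′<)
  maps′ : ∀ {k} → k < N → T (P k) → f k < M × T (R′ (f k))
  maps′ {k} k<N Pk with f k ≡ᵇ f N in fk≟fN
  ... | false = maps (m<n⇒m<1+n k<N) Pk
  ... | true  = contradiction (inj (m<n⇒m<1+n k<N) ≤-refl Pk PN fk≡fN) (<⇒≢ k<N)
    where fk≡fN = ≡ᵇ⇒≡ (f k) (f N) (subst T (sym fk≟fN) tt)

countBelow-none : ∀ N (P : ℕ → Bool) → (∀ {k} → k < N → ¬ T (P k)) → countBelow N P ≡ 0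
countBelow-none N P none = trans (∑-cong N (λ k<N → ¬T⇒⟦⟧≡0 (none k<N))) (trans (∑-const N 0) (*-zeroʳ N))

countBelow-≡ᵇ≤1 : ∀ N y → countBelow N (_≡ᵇ y) ≤ 1
countBelow-≡ᵇ≤1 N y = countBelow-≤-injection N 1 (_≡ᵇ y) (λ _ → true) (λ _ → 0) (λ _ _ → z<s , tt)
  (λ {k} {k′} _ _ k≡y k′≡y _ → trans (≡ᵇ⇒≡ k y k≡y) (sym (≡ᵇ⇒≡ k′ y k′≡y)))

⨆ : ℕ → (ℕ → ℕ) → ℕ
⨆ zero    f = 0
⨆ (suc N) f = f 0 ⊔ ⨆ N (f ∘ suc)

term≤⨆ : ∀ N (f : ℕ → ℕ) {k} → k < N → f k ≤ ⨆ N f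
term≤⨆ (suc N) f {zero}  _         = m≤m⊔n (f 0) _
term≤⨆ (suc N) f {suc k} (s<s k<N) = ≤-trans (term≤⨆ N (f ∘ suc) k<N) (m≤n⊔m (f 0) _)

⨆^m≤ : ∀ N (f : ℕ → ℕ) {m Z} → 0 < m → (∀ {k} → k < N → f k ^ m ≤ Z) → ⨆ N f ^ m ≤ Z
⨆^m≤ zero    f {suc m} _   _     = z≤n
⨆^m≤ (suc N) f         0<m bound with ⊔-sel (f 0) (⨆ N (f ∘ suc))
... | inj₁ ⊔≡f0 rewrite ⊔≡f0 = bound z<s
... | inj₂ ⊔≡⨆  rewrite ⊔≡⨆  = ⨆^m≤ N (f ∘ suc) 0<m (bound ∘ s<s)

^-distrib-* : ∀ m n k → (m * n) ^ k ≡ m ^ k * n ^ k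
^-distrib-* m n zero    = refl
^-distrib-* m n (suc k) = trans (cong (m * n *_) (^-distrib-* m n k)) (interchange m n (m ^ k) (n ^ k))
  where
  interchange : ∀ a b c d → a * b * (c * d) ≡ a * c * (b * d)
  interchange = solve-∀

1+n≤2^n : ∀ n → suc n ≤ 2 ^ n
1+n≤2^n zero    = ≤-refl
1+n≤2^n (suc n) = +-mono-≤ (m^n>0 2 n) (≤-trans (1+n≤2^n n) (≤-reflexive (sym (+-identityʳ _))))

[n∸1]*[m/n+1]≤m+n : ∀ m n .{{_ : NonZero n}} → (n ∸ 1) * (m / n + 1) ≤ m + n
[n∸1]*[m/n+1]≤m+n m n = begin
  (n ∸ 1) * (m / n + 1)
    ≤⟨ *-monoˡ-≤ (m / n + 1) (m∸n≤m n 1) ⟩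
  n * (m / n + 1)
    ≡⟨ *-distribˡ-+ n (m / n) 1 ⟩
  n * (m / n) + n * 1
    ≤⟨ +-mono-≤ (≤-trans (≤-reflexive (*-comm n (m / n))) (m/n*n≤m m n)) (≤-reflexive (*-identityʳ n)) ⟩
  m + n                           ∎
  where open ≤-Reasoning

0<∧<⇒∤ : ∀ {p x} → 0 < x → x < p → p ∤ x
0<∧<⇒∤ {x = suc x} _ x<p = >⇒∤ x<p

<∸1⇒suc< : ∀ {k p} → k < p ∸ 1 → suc k < p
<∸1⇒suc< {p = suc p} k<p-1 = s<s k<p-1

module _ {p : ℕ} .{{_ : NonZero p}} where

  %≡⇒∣∸ : ∀ {a b} → b ≤ a → a % p ≡ b % p → p ∣ a ∸ b
  %≡⇒∣∸ {a} {b} b≤a eq = divides (a / p ∸ b / p) (begin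
    a ∸ b                                    ≡⟨ cong₂ _∸_ (m≡m%n+[m/n]*n a p) (m≡m%n+[m/n]*n b p) ⟩
    (a % p + a / p * p) ∸ (b % p + b / p * p) ≡⟨ cong (λ r → (r + a / p * p) ∸ (b % p + b / p * p)) eq ⟩
    (b % p + a / p * p) ∸ (b % p + b / p * p) ≡⟨ [m+n]∸[m+o]≡n∸o (b % p) _ _ ⟩
    a / p * p ∸ b / p * p                    ≡⟨ *-distribʳ-∸ p (a / p) (b / p) ⟨
    (a / p ∸ b / p) * p                      ∎)
    where open ≡-Reasoning

  ∣∸⇒%≡ : ∀ {a b} → b ≤ a → p ∣ a ∸ b → a % p ≡ b % p
  ∣∸⇒%≡ {a} {b} b≤a (divides k eq) = begin
    a % p             ≡⟨ cong (_% p) (m+[n∸m]≡n b≤a) ⟨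
    (b + (a ∸ b)) % p ≡⟨ cong (λ d → (b + d) % p) eq ⟩
    (b + k * p) % p   ≡⟨ [m+kn]%n≡m%n b k p ⟩
    b % p             ∎
    where open ≡-Reasoning

  %-cong-*ʳ : ∀ {a b} c → a % p ≡ b % p → (a * c) % p ≡ (b * c) % p
  %-cong-*ʳ {a} {b} c eq = begin
    (a * c) % p             ≡⟨ %-distribˡ-* a c p ⟩
    (a % p * (c % p)) % p   ≡⟨ cong (λ r → (r * (c % p)) % p) eq ⟩
    (b % p * (c % p)) % p   ≡⟨ %-distribˡ-* b c p ⟨
    (b * c) % p             ∎
    where open ≡-Reasoning

  %-cong-*ˡ : ∀ c {a b} → a % p ≡ b % p → (c * a) % p ≡ (c * b) % p
  %-cong-*ˡ c {a} {b} eq rewrite *-comm c a | *-comm c b = %-cong-*ʳ c eq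

  %-cong-+ʳ : ∀ {a b} c → a % p ≡ b % p → (a + c) % p ≡ (b + c) % p
  %-cong-+ʳ {a} {b} c eq = begin
    (a + c) % p             ≡⟨ %-distribˡ-+ a c p ⟩
    (a % p + c % p) % p     ≡⟨ cong (λ r → (r + c % p) % p) eq ⟩
    (b % p + c % p) % p     ≡⟨ %-distribˡ-+ b c p ⟨
    (b + c) % p             ∎
    where open ≡-Reasoning

  %-cong-^ : ∀ {a b} k → a % p ≡ b % p → (a ^ k) % p ≡ (b ^ k) % p
  %-cong-^         zero    eq = refl
  %-cong-^ {a} {b} (suc k) eq =
    trans (%-cong-*ʳ (a ^ k) eq) (%-cong-*ˡ b (%-cong-^ k eq))

  %-injective-< : ∀ {x y} → x < p → y < p → x % p ≡ y % p → x ≡ y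
  %-injective-< x<p y<p eq = trans (sym (m<n⇒m%n≡m x<p)) (trans eq (m<n⇒m%n≡m y<p))

module _ {p : ℕ} (p-prime : Prime p) where
  private instance _ = prime⇒nonZero p-prime

  1<p : 1 < p
  1<p = nonTrivial⇒n>1 p {{prime⇒nonTrivial p-prime}}

  ∤-* : ∀ {a b} → p ∤ a → p ∤ b → p ∤ a * b
  ∤-* {a} {b} p∤a p∤b p∣ab with euclidsLemma a b p-prime p∣ab
  ... | inj₁ p∣a = p∤a p∣a
  ... | inj₂ p∣b = p∤b p∣b

  ∤1 : p ∤ 1
  ∤1 p∣1 = nonTrivial⇒≢1 {{prime⇒nonTrivial p-prime}} (∣1⇒≡1 p∣1)

  ∤-^ : ∀ {a} k → p ∤ a → p ∤ a ^ k
  ∤-^ zero    _       = ∤1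
  ∤-^ (suc k) p∤a     = ∤-* p∤a (∤-^ k p∤a)

  ∣*∤⇒∣ : ∀ {a g} → p ∤ g → p ∣ a * g → p ∣ a
  ∣*∤⇒∣ {a} {g} p∤g p∣ag with euclidsLemma a g p-prime p∣ag
  ... | inj₁ p∣a = p∣a
  ... | inj₂ p∣g = contradiction p∣g p∤g

  private
    %-cancel-*ʳ-≤ : ∀ {g x y} → x ≤ y → p ∤ g → (y * g) % p ≡ (x * g) % p → y % p ≡ x % p
    %-cancel-*ʳ-≤ {g} {x} {y} x≤y p∤g eq = ∣∸⇒%≡ x≤y (∣*∤⇒∣ p∤g
      (subst (p ∣_) (sym (*-distribʳ-∸ g y x)) (%≡⇒∣∸ (*-monoˡ-≤ g x≤y) eq)))

  %-cancel-*ʳ : ∀ {g} x y → p ∤ g → (x * g) % p ≡ (y * g) % p → x % p ≡ y % p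
  %-cancel-*ʳ x y p∤g eq with ≤-total x y
  ... | inj₁ x≤y = sym (%-cancel-*ʳ-≤ x≤y p∤g (sym eq))
  ... | inj₂ y≤x = %-cancel-*ʳ-≤ y≤x p∤g eq

  ∤-! : ∀ {j} → j < p → p ∤ j !
  ∤-! {zero}  _   = ∤1
  ∤-! {suc j} j<p = ∤-* (>⇒∤ j<p) (∤-! (<-trans (n<1+n j) j<p))

  prime∣C : ∀ {k} → 0 < k → k < p → p ∣ p C k
  prime∣C {k} 0<k k<p = ∣*∤⇒∣ (∤-* (∤-! k<p) (∤-! (∸-monoʳ-< 0<k (<⇒≤ k<p))))
    (subst (p ∣_) (sym C*D≡p!) p∣p!)
    where
    instance _ = k !* (p ∸ k) !≢0
    C*D≡p! : (p C k) * (k ! * (p ∸ k) !) ≡ p !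
    C*D≡p! = trans (cong (_* (k ! * (p ∸ k) !)) (nCk≡n!/k![n-k]! (<⇒≤ k<p)))
                   (m/n*n≡m (k![n∸k]!∣n! (<⇒≤ k<p)))
    p∣p! : p ∣ p !
    p∣p! = n∣n!
      where
      n∣n! : ∀ {n} → .{{NonZero n}} → n ∣ n !
      n∣n! {suc n} = m∣m*n (n !)

-- Fermat's little theorem

binomial-+1 : ∀ n x → (x + 1) ^ n ≡ ∑ (suc n) (λ k → (n C k) * x ^ k)
binomial-+1 zero    x = refl
binomial-+1 (suc n) x = begin
  (x + 1) * (x + 1) ^ n                        ≡⟨ cong ((x + 1) *_) (binomial-+1 n x) ⟩
  (x + 1) * B                                  ≡⟨ *-distribʳ-+ B x 1 ⟩
  x * B + 1 * B                                ≡⟨ cong₂ _+_ (*-distribˡ-∑ (suc n) x term) (*-identityˡ B) ⟩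
  ∑ (suc n) (λ k → x * term k) + B             ≡⟨ cong₂ _+_ (∑-cong (suc n) (λ {k} _ → shift k)) B≡ ⟩
  ∑ (suc n) lower + (1 + ∑ (suc n) upper)      ≡⟨ +-suc _ _ ⟩
  1 + (∑ (suc n) lower + ∑ (suc n) upper)      ≡⟨ cong (1 +_) (∑-distrib-+ (suc n) lower upper) ⟨
  1 + ∑ (suc n) (λ k → lower k + upper k)      ≡⟨ cong (1 +_) (∑-cong (suc n) (λ {k} _ → pascal k)) ⟩
  ∑ (suc (suc n)) (λ k → (suc n C k) * x ^ k)  ∎
  where
  open ≡-Reasoning
  term lower upper : ℕ → ℕ
  term  k = (n C k) * x ^ k
  lower k = (n C k) * x ^ suc k
  upper k = (n C suc k) * x ^ suc k
  B = ∑ (suc n) term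
  shift : ∀ k → x * term k ≡ lower k
  shift k = x*yz≡y*xz x (n C k) (x ^ k)
    where
    x*yz≡y*xz : ∀ a b c → a * (b * c) ≡ b * (a * c)
    x*yz≡y*xz = solve-∀
  pascal : ∀ k → lower k + upper k ≡ (suc n C suc k) * x ^ suc k
  pascal k = trans (sym (*-distribʳ-+ (x ^ suc k) (n C k) _)) (cong (_* x ^ suc k) (nCk+nC[k+1]≡[n+1]C[k+1] n k))
  B≡ : B ≡ 1 + ∑ (suc n) upper
  B≡ = begin
    B                             ≡⟨ +-identityʳ B ⟨
    B + 0                         ≡⟨ cong (λ c → B + c * x ^ suc n) (k>n⇒nCk≡0 (n<1+n n)) ⟨
    B + term (suc n)              ≡⟨ ∑-init-last (suc n) term ⟨
    ∑ (suc (suc n)) term          ∎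

frobenius-+1 : ∀ {p} .{{_ : NonZero p}} → Prime p → ∀ x → ((x + 1) ^ p) % p ≡ (x ^ p + 1) % p
frobenius-+1 {p@(suc q)} p-prime x = begin
  ((x + 1) ^ p) % p                          ≡⟨ cong (_% p) (binomial-+1 p x) ⟩
  (1 + ∑ p (λ k → (p C suc k) * x ^ suc k)) % p ≡⟨ cong (λ s → (1 + s) % p) (∑-init-last q _) ⟩
  (1 + (M + (p C p) * x ^ p)) % p             ≡⟨ cong (λ c → (1 + (M + c * x ^ p)) % p) (nCn≡1 p) ⟩
  (1 + (M + 1 * x ^ p)) % p                   ≡⟨ cong (_% p) (rearrange M (x ^ p)) ⟩
  (M + (x ^ p + 1)) % p                       ≡⟨ %-remove-+ˡ (x ^ p + 1) p∣M ⟩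
  (x ^ p + 1) % p                             ∎
  where
  open ≡-Reasoning
  M = ∑ q (λ k → (p C suc k) * x ^ suc k)
  p∣M : p ∣ M
  p∣M = ∣-∑ q _ (λ k<q → ∣m⇒∣m*n _ (prime∣C p-prime z<s (s<s k<q)))
  rearrange : ∀ m y → 1 + (m + 1 * y) ≡ m + (y + 1)
  rearrange = solve-∀

fermat-^p : ∀ {p} .{{_ : NonZero p}} → Prime p → ∀ x → (x ^ p) % p ≡ x % p
fermat-^p {suc q} p-prime zero    = refl
fermat-^p {p}     p-prime (suc x) = begin
  (suc x ^ p) % p   ≡⟨ cong (λ y → (y ^ p) % p) (+-comm 1 x) ⟩
  ((x + 1) ^ p) % p ≡⟨ frobenius-+1 p-prime x ⟩
  (x ^ p + 1) % p   ≡⟨ %-cong-+ʳ 1 (fermat-^p p-prime x) ⟩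
  (x + 1) % p       ≡⟨ cong (_% p) (+-comm x 1) ⟩
  suc x % p         ∎
  where open ≡-Reasoning

fermat : ∀ {p} .{{_ : NonZero p}} → Prime p → ∀ {z} → p ∤ z → (z ^ (p ∸ 1)) % p ≡ 1
fermat {p@(suc (suc q))} p-prime {z} p∤z = trans
  (%-cancel-*ʳ p-prime (z ^ suc q) 1 p∤z
    (trans (cong (_% p) (*-comm (z ^ suc q) z)) (trans (fermat-^p p-prime z) (cong (_% p) (sym (*-identityˡ z))))))
  (m<n⇒m%n≡m (s<s z<s))

-- Lagrange's theorem for monic polynomials modulo p

data Monic : ℕ → Set where
  one  : Monic 0
  _x+_ : ∀ {d} → Monic d → ℕ → Monic (suc d)

eval : ∀ {d} → Monic d → ℕ → ℕ
eval one      x = 1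
eval (P x+ c) x = x * eval P x + c

divByLinear : ∀ {d} → Monic (suc d) → ℕ → Monic d
divByLinear (one      x+ c) r = one
divByLinear ((P x+ c′) x+ c) r = divByLinear (P x+ c′) r x+ eval (P x+ c′) r

-- P(x) − P(r) = (x − r) · Q(x), with both sides moved so that no subtraction occurs.
eval-divByLinear : ∀ {d} (P : Monic (suc d)) x r →
  eval P x + r * eval (divByLinear P r) x ≡ x * eval (divByLinear P r) x + eval P r
eval-divByLinear (one x+ c) x r = identity x c r
  where
  identity : ∀ x c r → x * 1 + c + r * 1 ≡ x * 1 + (r * 1 + c)
  identity = solve-∀
eval-divByLinear ((P x+ c′) x+ c) x r = begin
  x * Px + c + r * (x * Qx + Pr) ≡⟨ regroup₁ x Px c r Qx Pr ⟩
  x * (Px + r * Qx) + c + r * Pr ≡⟨ cong (λ y → x * y + c + r * Pr) (eval-divByLinear (P x+ c′) x r) ⟩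
  x * (x * Qx + Pr) + c + r * Pr ≡⟨ regroup₂ x Qx Pr c r ⟩
  x * (x * Qx + Pr) + (r * Pr + c) ∎
  where
  open ≡-Reasoning
  Px = eval (P x+ c′) x
  Pr = eval (P x+ c′) r
  Qx = eval (divByLinear (P x+ c′) r) x
  regroup₁ : ∀ x Px c r Qx Pr → x * Px + c + r * (x * Qx + Pr) ≡ x * (Px + r * Qx) + c + r * Pr
  regroup₁ = solve-∀
  regroup₂ : ∀ x Qx Pr c r → x * (x * Qx + Pr) + c + r * Pr ≡ x * (x * Qx + Pr) + (r * Pr + c)
  regroup₂ = solve-∀

X^ : ∀ t → Monic t
X^ zero    = one
X^ (suc t) = X^ t x+ 0

eval-X^ : ∀ t x → eval (X^ t) x ≡ x ^ t
eval-X^ zero    x = refl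
eval-X^ (suc t) x = trans (+-identityʳ _) (cong (x *_) (eval-X^ t x))

module _ {p : ℕ} (p-prime : Prime p) where
  private instance _ = prime⇒nonZero p-prime

  isRoot : ∀ {d} → Monic d → ℕ → Bool
  isRoot P k = eval P (suc k) % p ≡ᵇ 0

  lagrange : ∀ {d} (P : Monic d) → countBelow (p ∸ 1) (isRoot P) ≤ d
  lagrange one = ≤-reflexive (countBelow-none (p ∸ 1) _ (λ _ 1%p≡0 →
    0≢1+n (trans (sym (≡ᵇ⇒≡ _ 0 1%p≡0)) (m<n⇒m%n≡m (1<p p-prime)))))
  lagrange {suc d} P with anyUpTo? (λ k → eval P (suc k) % p ≟ 0) (p ∸ 1)
  ... | no noRoot = ≤-trans (≤-reflexive (countBelow-none (p ∸ 1) _ λ k< root →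
    noRoot (_ , k< , ≡ᵇ⇒≡ _ 0 root))) z≤n
  ... | yes (k₀ , k₀< , P[r]≡0) = begin
    countBelow (p ∸ 1) (isRoot P)
      ≤⟨ ∑-mono-≤ (p ∸ 1) (λ k< → ⟦⟧-≤-+ (r-or-root-of-Q k<)) ⟩
    ∑ (p ∸ 1) (λ k → ⟦ k ≡ᵇ k₀ ⟧ + ⟦ isRoot Q k ⟧)
      ≡⟨ ∑-distrib-+ (p ∸ 1) _ _ ⟩
    countBelow (p ∸ 1) (_≡ᵇ k₀) + countBelow (p ∸ 1) (isRoot Q)
      ≤⟨ +-mono-≤ (countBelow-≡ᵇ≤1 (p ∸ 1) k₀) (lagrange Q) ⟩
    1 + d
      ∎
    where
    open ≤-Reasoning
    r = suc k₀
    Q = divByLinear P r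
    r-or-root-of-Q : ∀ {k} → k < p ∸ 1 → T (isRoot P k) → T (k ≡ᵇ k₀) ⊎ T (isRoot Q k)
    r-or-root-of-Q {k} k< P[x]≡0 with eval Q (suc k) % p ≟ 0
    ... | yes Q[x]≡0 = inj₂ (≡⇒≡ᵇ _ 0 Q[x]≡0)
    ... | no  Q[x]≢0 = inj₁ (≡⇒≡ᵇ k k₀ (suc-injective (%-injective-< (<∸1⇒suc< k<) (<∸1⇒suc< k₀<) x≡r)))
      where
      x = suc k
      rQ≡xQ : (r * eval Q x) % p ≡ (x * eval Q x) % p
      rQ≡xQ = begin-equality
        (r * eval Q x) % p                ≡⟨ %-remove-+ˡ _ (m%n≡0⇒n∣m _ p (≡ᵇ⇒≡ _ 0 P[x]≡0)) ⟨
        (eval P x + r * eval Q x) % p     ≡⟨ cong (_% p) (eval-divByLinear P x r) ⟩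
        (x * eval Q x + eval P r) % p     ≡⟨ %-remove-+ʳ _ (m%n≡0⇒n∣m _ p P[r]≡0) ⟩
        (x * eval Q x) % p                ∎
      x≡r : x % p ≡ r % p
      x≡r = sym (%-cancel-*ʳ p-prime r x (Q[x]≢0 ∘ n∣m⇒m%n≡0 _ p) rQ≡xQ)

  -- xᵗ + (p − 1) plays the role of xᵗ − 1.
  roots-of-unity : ∀ t → 0 < t → countBelow (p ∸ 1) (λ k → suc k ^ t % p ≡ᵇ 1) ≤ t
  roots-of-unity (suc t) _ = ≤-trans (∑-mono-≤ (p ∸ 1) (λ _ → ⟦⟧-mono root)) (lagrange (X^ t x+ (p ∸ 1)))
    where
    root : ∀ {k} → T (suc k ^ suc t % p ≡ᵇ 1) → T (isRoot (X^ t x+ (p ∸ 1)) k)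
    root {k} g^t≡1 = ≡⇒≡ᵇ _ 0 (begin
      (g * eval (X^ t) g + (p ∸ 1)) % p  ≡⟨ cong (λ y → (g * y + (p ∸ 1)) % p) (eval-X^ t g) ⟩
      (g ^ suc t + (p ∸ 1)) % p          ≡⟨ %-cong-+ʳ {a = g ^ suc t} (p ∸ 1) g^t≡1%p ⟩
      (1 + (p ∸ 1)) % p                  ≡⟨ cong (_% p) (m+[n∸m]≡n (<⇒≤ (1<p p-prime))) ⟩
      p % p                              ≡⟨ n%n≡0 p ⟩
      0                                  ∎)
      where
      open ≡-Reasoning
      g = suc k
      g^t≡1%p : (g ^ suc t) % p ≡ 1 % p
      g^t≡1%p = trans (≡ᵇ⇒≡ _ 1 g^t≡1) (sym (m<n⇒m%n≡m (1<p p-prime)))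

-- e-th power residues

ratioIsResidue⁻ : ∀ {p} .{{_ : NonZero p}} {e h k} → T (ratioIsResidue p e h k) →
  ∃ λ z → 0 < z × z < p × (k * z ^ e) % p ≡ h % p
ratioIsResidue⁻ {suc q} {e} {h} {k} isResidue
  with applyUpTo⁻ suc (any⁻ _ _ (subst (T ∘ any test) (map-applyUpTo id suc q) isResidue))
  where test = λ z → (k * z ^ e) % suc q ≡ᵇ h % suc q
... | i , i<q , kz^e≡h = suc i , z<s , s<s i<q , ≡ᵇ⇒≡ _ _ kz^e≡h

ratioIsResidue⁺ : ∀ {p} .{{_ : NonZero p}} {e h k z} → 0 < z → z < p → (k * z ^ e) % p ≡ h % p →
  T (ratioIsResidue p e h k)
ratioIsResidue⁺ {suc q} {e} {h} {k} {suc i} _ (s<s i<q) kz^e≡h =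
  subst (T ∘ any test) (sym (map-applyUpTo id suc q)) (any⁺ test (applyUpTo⁺ suc (≡⇒≡ᵇ _ _ kz^e≡h) i<q))
  where test = λ z → (k * z ^ e) % suc q ≡ᵇ h % suc q

module _ {p : ℕ} (p-prime : Prime p) where
  private instance _ = prime⇒nonZero p-prime

  ratioIsResidue-* : ∀ {e h k a b} → T (ratioIsResidue p e h k) → T (ratioIsResidue p e a b) →
    T (ratioIsResidue p e (h * a) (k * b))
  ratioIsResidue-* {e} {h} {k} {a} {b} hk ab with ratioIsResidue⁻ {p} hk | ratioIsResidue⁻ {p} ab
  ... | z , 0<z , z<p , kz^e≡h | w , 0<w , w<p , bw^e≡a = ratioIsResidue⁺ 0<u (m%n<n (z * w) p) (begin
    (k * b * u ^ e) % p             ≡⟨ %-cong-*ˡ (k * b) (%-cong-^ e (m%n%n≡m%n (z * w) p)) ⟩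
    (k * b * (z * w) ^ e) % p       ≡⟨ cong (λ y → (k * b * y) % p) (^-distrib-* z w e) ⟩
    (k * b * (z ^ e * w ^ e)) % p   ≡⟨ cong (_% p) (interchange k b (z ^ e) (w ^ e)) ⟩
    (k * z ^ e * (b * w ^ e)) % p   ≡⟨ %-distribˡ-* (k * z ^ e) _ p ⟩
    (((k * z ^ e) % p) * ((b * w ^ e) % p)) % p ≡⟨ cong₂ (λ x y → (x * y) % p) kz^e≡h bw^e≡a ⟩
    ((h % p) * (a % p)) % p         ≡⟨ %-distribˡ-* h a p ⟨
    (h * a) % p                     ∎)
    where
    open ≡-Reasoning
    u = (z * w) % p
    0<u : 0 < u
    0<u = n≢0⇒n>0 (λ u≡0 → ∤-* p-prime (0<∧<⇒∤ 0<z z<p) (0<∧<⇒∤ 0<w w<p) (m%n≡0⇒n∣m _ p u≡0))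
    interchange : ∀ a b c d → a * b * (c * d) ≡ a * c * (b * d)
    interchange = solve-∀

  countBelow-class : ∀ {g} → p ∤ g → ∀ c X → countBelow X (λ b → (suc b * g) % p ≡ᵇ c) ≤ X / p + 1
  countBelow-class {g} p∤g c X = begin
    countBelow X (λ b → (suc b * g) % p ≡ᵇ c)
      ≤⟨ countBelow-≤-injection X (X / p + 1) _ (λ _ → true) (λ b → suc b / p) maps inj ⟩
    countBelow (X / p + 1) (λ _ → true)
      ≡⟨ trans (∑-const (X / p + 1) 1) (*-identityʳ _) ⟩
    X / p + 1                                 ∎
    where
    open ≤-Reasoning
    maps : ∀ {b} → b < X → _ → suc b / p < X / p + 1 × T true
    maps b<X _ = ≤-trans (s≤s (/-monoˡ-≤ p b<X)) (≤-reflexive (+-comm 1 (X / p))) , tt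
    inj : ∀ {b b′} → b < X → b′ < X → T ((suc b * g) % p ≡ᵇ c) → T ((suc b′ * g) % p ≡ᵇ c) →
      suc b / p ≡ suc b′ / p → b ≡ b′
    inj {b} {b′} _ _ bg≡c b′g≡c quot≡ = suc-injective (begin-equality
      suc b                       ≡⟨ m≡m%n+[m/n]*n (suc b) p ⟩
      suc b % p + suc b / p * p   ≡⟨ cong₂ (λ r q → r + q * p) rem≡ quot≡ ⟩
      suc b′ % p + suc b′ / p * p ≡⟨ m≡m%n+[m/n]*n (suc b′) p ⟨
      suc b′                      ∎)
      where
      rem≡ : suc b % p ≡ suc b′ % p
      rem≡ = %-cancel-*ʳ p-prime (suc b) (suc b′) p∤g (trans (≡ᵇ⇒≡ _ c bg≡c) (sym (≡ᵇ⇒≡ _ c b′g≡c)))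

  ratioIsResidue≤∑ : ∀ {e t} → e * t ≡ p ∸ 1 → ∀ a b →
    ⟦ ratioIsResidue p e a b ⟧ ≤ ∑ (p ∸ 1) (λ k → ⟦ suc k ^ t % p ≡ᵇ 1 ⟧ * ⟦ (b * suc k) % p ≡ᵇ a % p ⟧)
  ratioIsResidue≤∑ {e} {t} et≡p-1 a b with T? (ratioIsResidue p e a b)
  ... | no  ¬res = ≤-trans (≤-reflexive (¬T⇒⟦⟧≡0 ¬res)) z≤n
  ... | yes res with ratioIsResidue⁻ {p} res
  ...   | z , 0<z , z<p , bz^e≡a = begin
    ⟦ ratioIsResidue p e a b ⟧  ≡⟨ T⇒⟦⟧≡1 res ⟩
    1                          ≡⟨ cong₂ _*_ (T⇒⟦⟧≡1 (≡⇒≡ᵇ _ 1 g^t≡1)) (T⇒⟦⟧≡1 (≡⇒≡ᵇ _ _ bg≡a)) ⟨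
    term g                     ≤⟨ term≤∑∘suc (p ∸ 1) term 0<g (∸-monoˡ-≤ 1 (m%n<n (z ^ e) p)) ⟩
    ∑ (p ∸ 1) (term ∘ suc)     ∎
    where
    open ≤-Reasoning
    term : ℕ → ℕ
    term r = ⟦ r ^ t % p ≡ᵇ 1 ⟧ * ⟦ (b * r) % p ≡ᵇ a % p ⟧
    g = (z ^ e) % p
    p∤z^e : p ∤ z ^ e
    p∤z^e = ∤-^ p-prime e (0<∧<⇒∤ 0<z z<p)
    0<g : 0 < g
    0<g = n≢0⇒n>0 (p∤z^e ∘ m%n≡0⇒n∣m _ p)
    g^t≡1 : g ^ t % p ≡ 1
    g^t≡1 = begin-equality
      g ^ t % p           ≡⟨ %-cong-^ t (m%n%n≡m%n (z ^ e) p) ⟩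
      (z ^ e) ^ t % p     ≡⟨ cong (_% p) (^-*-assoc z e t) ⟩
      z ^ (e * t) % p     ≡⟨ cong (λ n → z ^ n % p) et≡p-1 ⟩
      z ^ (p ∸ 1) % p     ≡⟨ fermat p-prime (0<∧<⇒∤ 0<z z<p) ⟩
      1                   ∎
    bg≡a : (b * g) % p ≡ a % p
    bg≡a = trans (%-cong-*ˡ b (m%n%n≡m%n (z ^ e) p)) bz^e≡a

  countBelow-ratioIsResidue : ∀ {e t} → 0 < t → e * t ≡ p ∸ 1 → ∀ a X →
    countBelow X (λ b → ratioIsResidue p e a (suc b)) ≤ t * (X / p + 1)
  countBelow-ratioIsResidue {e} {t} 0<t et≡p-1 a X = begin
    countBelow X (λ b → ratioIsResidue p e a (suc b))
      ≤⟨ ∑-mono-≤ X (λ {b} _ → ratioIsResidue≤∑ et≡p-1 a (suc b)) ⟩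
    ∑ X (λ b → ∑ (p ∸ 1) (λ k → root k * class b k))
      ≡⟨ ∑-comm X (p ∸ 1) _ ⟩
    ∑ (p ∸ 1) (λ k → ∑ X (λ b → root k * class b k))
      ≡⟨ ∑-cong (p ∸ 1) (λ {k} _ → *-distribˡ-∑ X (root k) (λ b → class b k)) ⟨
    ∑ (p ∸ 1) (λ k → root k * ∑ X (λ b → class b k))
      ≤⟨ ∑-mono-≤ (p ∸ 1) (λ {k} k< → *-monoʳ-≤ (root k) (countBelow-class (unit k<) (a % p) X)) ⟩
    ∑ (p ∸ 1) (λ k → root k * (X / p + 1))
      ≡⟨ *-distribʳ-∑ (p ∸ 1) (X / p + 1) root ⟨
    countBelow (p ∸ 1) (λ k → suc k ^ t % p ≡ᵇ 1) * (X / p + 1)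
      ≤⟨ *-monoˡ-≤ (X / p + 1) (roots-of-unity p-prime t 0<t) ⟩
    t * (X / p + 1) ∎
    where
    open ≤-Reasoning
    root : ℕ → ℕ
    root k = ⟦ suc k ^ t % p ≡ᵇ 1 ⟧
    class : ℕ → ℕ → ℕ
    class b k = ⟦ (suc b * suc k) % p ≡ᵇ a % p ⟧
    unit : ∀ {k} → k < p ∸ 1 → p ∤ suc k
    unit k< = 0<∧<⇒∤ z<s (<∸1⇒suc< k<)

-- The divisor function

infix 4 _∣ᵇ_

_∣ᵇ_ : ℕ → ℕ → Bool
d ∣ᵇ b = isYes (d ∣? b)

∣ᵇ⇒∣ : ∀ {d b} → T (d ∣ᵇ b) → d ∣ b
∣ᵇ⇒∣ {d} {b} = toWitness {a? = d ∣? b}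

∣⇒∣ᵇ : ∀ {d b} → d ∣ b → T (d ∣ᵇ b)
∣⇒∣ᵇ {d} {b} = fromWitness {a? = d ∣? b}

τ : ℕ → ℕ
τ b = countBelow b (λ k → suc k ∣ᵇ b)

countBelow-divisors≤τ : ∀ N {b} → 0 < b → countBelow N (λ k → suc k ∣ᵇ b) ≤ τ b
countBelow-divisors≤τ N {b} 0<b = countBelow-≤-injection N b _ _ id
  (λ _ k+1∣b → ∣⇒≤ {{>-nonZero 0<b}} (∣ᵇ⇒∣ k+1∣b) , k+1∣b) (λ _ _ _ _ → id)

τ-mono-∣ : ∀ {b c} → 0 < b → c ∣ b → τ c ≤ τ b
τ-mono-∣ {b} {c} 0<b c∣b = countBelow-≤-injection c b _ _ id
  (λ _ k+1∣c → let k+1∣b = ∣-trans (∣ᵇ⇒∣ k+1∣c) c∣b in ∣⇒≤ {{>-nonZero 0<b}} k+1∣b , ∣⇒∣ᵇ k+1∣b)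
  (λ _ _ _ _ → id)

module _ {q : ℕ} (q-prime : Prime q) where
  private instance _ = prime⇒nonZero q-prime

  ∤⇒coprime : ∀ {k} → q ∤ k → Coprime k q
  ∤⇒coprime {k} q∤k with prime⇒irreducible q-prime (gcd[m,n]∣n k q)
  ... | inj₁ gcd≡1 = gcd≡1⇒coprime gcd≡1
  ... | inj₂ gcd≡q = contradiction (subst (_∣ k) gcd≡q (gcd[m,n]∣m k q)) q∤k

  ∣q*⇒ : ∀ {k m} → k ∣ q * m → k ∣ m ⊎ ∃ λ j → k ≡ q * j × j ∣ m
  ∣q*⇒ {k} {m} k∣qm with q ∣? k
  ... | no  q∤k = inj₁ (coprime-divisor (∤⇒coprime q∤k) k∣qm)
  ... | yes (divides j k≡jq) = inj₂ (j , k≡qj , *-cancelˡ-∣ q (subst (_∣ q * m) k≡qj k∣qm))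
    where k≡qj = trans k≡jq (*-comm j q)

  ∣q^[1+α]*⇒ : ∀ α {c k} → k ∣ q ^ suc α * c → k ∤ q ^ α * c → ∃ λ j → k ≡ q ^ suc α * j × j ∣ c
  ∣q^[1+α]*⇒ α {c} {k} k∣ k∤ with ∣q*⇒ (subst (k ∣_) (*-assoc q (q ^ α) c) k∣)
  ... | inj₁ k∣q^αc = contradiction k∣q^αc k∤
  ∣q^[1+α]*⇒ zero {c} k∣ k∤ | inj₂ (j , k≡qj , j∣1*c) =
    j , trans k≡qj (cong (_* j) (sym (*-identityʳ q))) , subst (j ∣_) (+-identityʳ c) j∣1*c
  ∣q^[1+α]*⇒ (suc α) {c} {k} k∣ k∤ | inj₂ (j , k≡qj , j∣q^[1+α]c) with ∣q^[1+α]*⇒ α j∣q^[1+α]c j∤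
    where
    j∤ : j ∤ q ^ α * c
    j∤ j∣ = k∤ (subst (k ∣_) (sym (*-assoc q (q ^ α) c))
                      (subst (_∣ q * (q ^ α * c)) (sym k≡qj) (*-monoʳ-∣ q j∣)))
  ... | j′ , j≡ , j′∣c = j′ , trans k≡qj (trans (cong (q *_) j≡) (sym (*-assoc q (q ^ suc α) j′))) , j′∣c

  new-divisors≤τ : ∀ α {c} → 0 < c →
    countBelow (q ^ suc α * c) (λ k → (suc k ∣ᵇ q ^ suc α * c) ∧ not (suc k ∣ᵇ q ^ α * c)) ≤ τ c
  new-divisors≤τ α {c} 0<c = countBelow-≤-injection (Q * c) c new (λ y → suc y ∣ᵇ c) f maps inj
    where
    Q = q ^ suc α
    instance _ = m^n≢0 q (suc α)
    new : ℕ → Bool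
    new k = (suc k ∣ᵇ Q * c) ∧ not (suc k ∣ᵇ q ^ α * c)
    cofactor : ∀ {k} → T (new k) → ∃ λ j → suc k ≡ Q * j × j ∣ c
    cofactor nk = ∣q^[1+α]*⇒ α (∣ᵇ⇒∣ (proj₁ (T-∧-not⁻ nk))) (proj₂ (T-∧-not⁻ nk) ∘ ∣⇒∣ᵇ)
    f : ℕ → ℕ
    f k = pred (suc k / Q)
    f-cofactor : ∀ {k j} → suc k ≡ Q * j → suc (f k) ≡ j
    f-cofactor {k} {zero}  eq = contradiction (trans eq (*-zeroʳ Q)) 1+n≢0
    f-cofactor {k} {suc j} eq =
      cong (suc ∘ pred) (trans (cong (_/ Q) (trans eq (*-comm Q (suc j)))) (m*n/n≡m (suc j) Q))
    maps : ∀ {k} → k < Q * c → T (new k) → f k < c × T (suc (f k) ∣ᵇ c)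
    maps _ nk with cofactor nk
    ... | j , eq , j∣c = subst (_≤ c) (sym (f-cofactor eq)) (∣⇒≤ {{>-nonZero 0<c}} j∣c)
                       , subst (λ i → T (i ∣ᵇ c)) (sym (f-cofactor eq)) (∣⇒∣ᵇ j∣c)
    inj : ∀ {k k′} → k < Q * c → k′ < Q * c → T (new k) → T (new k′) → f k ≡ f k′ → k ≡ k′
    inj _ _ nk nk′ fk≡fk′ with cofactor nk | cofactor nk′
    ... | j , eq , _ | j′ , eq′ , _ = suc-injective (trans eq (trans (cong (Q *_) j≡j′) (sym eq′)))
      where j≡j′ = trans (sym (f-cofactor eq)) (trans (cong suc fk≡fk′) (f-cofactor eq′))

  τ-q^[1+α]* : ∀ α {c} → 0 < c → τ (q ^ suc α * c) ≤ τ (q ^ α * c) + τ c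
  τ-q^[1+α]* α {c} 0<c = begin
    τ N
      ≤⟨ ∑-mono-≤ N (λ {k} _ → ⟦⟧≤⟦⟧+⟦∧not⟧ (suc k ∣ᵇ N) (suc k ∣ᵇ M)) ⟩
    ∑ N (λ k → ⟦ suc k ∣ᵇ M ⟧ + ⟦ new k ⟧)
      ≡⟨ ∑-distrib-+ N _ _ ⟩
    countBelow N (λ k → suc k ∣ᵇ M) + countBelow N new
      ≤⟨ +-mono-≤ (countBelow-divisors≤τ N 0<M) (new-divisors≤τ α 0<c) ⟩
    τ M + τ c                                            ∎
    where
    open ≤-Reasoning
    N = q ^ suc α * c
    M = q ^ α * c
    0<M : 0 < M
    0<M = *-mono-≤ (m^n>0 q α) 0<c
    new : ℕ → Bool
    new k = (suc k ∣ᵇ N) ∧ not (suc k ∣ᵇ M)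

  τ-q^α* : ∀ α {c} → 0 < c → τ (q ^ α * c) ≤ suc α * τ c
  τ-q^α* zero    {c} _   = ≤-reflexive (trans (cong τ (+-identityʳ c)) (sym (+-identityʳ (τ c))))
  τ-q^α* (suc α) {c} 0<c = begin
    τ (q ^ suc α * c)        ≤⟨ τ-q^[1+α]* α 0<c ⟩
    τ (q ^ α * c) + τ c      ≤⟨ +-monoˡ-≤ (τ c) (τ-q^α* α 0<c) ⟩
    suc α * τ c + τ c        ≡⟨ +-comm _ (τ c) ⟩
    suc (suc α) * τ c        ∎
    where open ≤-Reasoning

  factor-out : ∀ {b} → 0 < b → ∃₂ λ α c → b ≡ q ^ α * c × q ∤ c
  factor-out {b} = <-rec (λ b → 0 < b → ∃₂ λ α c → b ≡ q ^ α * c × q ∤ c) step b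
    where
    step : ∀ b → (∀ {b′} → b′ < b → 0 < b′ → ∃₂ λ α c → b′ ≡ q ^ α * c × q ∤ c) →
      0 < b → ∃₂ λ α c → b ≡ q ^ α * c × q ∤ c
    step b rec 0<b with q ∣? b
    ... | no  q∤b = 0 , b , sym (+-identityʳ b) , q∤b
    ... | yes (divides zero b≡0) = contradiction (trans b≡0 (*-zeroˡ q)) (>⇒≢ 0<b)
    ... | yes q∣b@(divides b′@(suc _) b≡b′q)
      with rec (quotient-< q∣b {{prime⇒nonTrivial q-prime}} {{>-nonZero 0<b}}) z<s
    ...   | α , c , b′≡q^αc , q∤c = suc α , c , b≡ , q∤c
      where
      b≡ : b ≡ q ^ suc α * c
      b≡ = trans b≡b′q (trans (cong (_* q) b′≡q^αc) (rotate (q ^ α) c q))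
        where
        rotate : ∀ x c q → x * c * q ≡ q * x * c
        rotate = solve-∀

prime-factor : ∀ {b} → 1 < b → ∃ λ r → Prime r × r ∣ b
prime-factor {b} 1<b with factorise b {{>-nonZero (<-trans z<s 1<b)}}
... | record { factors = []     ; isFactorisation = b≡1 } = contradiction b≡1 (>⇒≢ 1<b)
... | record { factors = r ∷ rs ; isFactorisation = b≡r*rs ; factorsPrime = r-prime ∷ _ } =
  r , r-prime , divides (product rs) (trans b≡r*rs (*-comm r (product rs)))

module _ (K : ℕ) .{{_ : NonZero K}} where

  [1+α]^K≤K^K*2^α : ∀ α → suc α ^ K ≤ K ^ K * 2 ^ α
  [1+α]^K≤K^K*2^α α = begin
    suc α ^ K             ≤⟨ ^-monoˡ-≤ K 1+α≤K[1+β] ⟩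
    (K * suc β) ^ K       ≡⟨ ^-distrib-* K (suc β) K ⟩
    K ^ K * suc β ^ K     ≤⟨ *-monoʳ-≤ (K ^ K) (^-monoˡ-≤ K (1+n≤2^n β)) ⟩
    K ^ K * (2 ^ β) ^ K   ≡⟨ cong (K ^ K *_) (^-*-assoc 2 β K) ⟩
    K ^ K * 2 ^ (β * K)   ≤⟨ *-monoʳ-≤ (K ^ K) (^-monoʳ-≤ 2 (m/n*n≤m α K)) ⟩
    K ^ K * 2 ^ α         ∎
    where
    open ≤-Reasoning
    β = α / K
    1+α≤K[1+β] : suc α ≤ K * suc β
    1+α≤K[1+β] = begin
      suc α               ≡⟨ cong suc (m≡m%n+[m/n]*n α K) ⟩
      suc (α % K + β * K) ≤⟨ +-monoˡ-≤ (β * K) (m%n<n α K) ⟩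
      K + β * K           ≡⟨ *-comm (suc β) K ⟩
      K * suc β           ∎

  [1+α]^K≤y^α : ∀ α {y} → 2 ^ K ≤ y → suc α ^ K ≤ y ^ α
  [1+α]^K≤y^α α {y} 2^K≤y = begin
    suc α ^ K     ≤⟨ ^-monoˡ-≤ K (1+n≤2^n α) ⟩
    (2 ^ α) ^ K   ≡⟨ ^-*-assoc 2 α K ⟩
    2 ^ (α * K)   ≡⟨ cong (2 ^_) (*-comm α K) ⟩
    2 ^ (K * α)   ≡⟨ ^-*-assoc 2 K α ⟨
    (2 ^ K) ^ α   ≤⟨ ^-monoˡ-≤ α 2^K≤y ⟩
    y ^ α         ∎
    where open ≤-Reasoning

  private
    A = K ^ K
    B = 2 ^ K
    instance _ = m^n≢0 K K

  -- Peeling off the prime factors s in increasing order: a prime s < 2ᴷ of multiplicity α costs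
  -- (α + 1)ᴷ ≤ A · sᵅ, so A is paid at most once per integer below 2ᴷ, while for s ≥ 2ᴷ already
  -- (α + 1)ᴷ ≤ sᵅ. The exponent s ⊓ B records how many of these payments have been made.
  weight-step : ∀ α {s} → 2 ≤ s → suc α ^ K * A ^ (s ⊓ B) ≤ s ^ α * A ^ (suc s ⊓ B)
  weight-step α {s} 2≤s with s <? B
  ... | yes s<B rewrite m≤n⇒m⊓n≡m (<⇒≤ s<B) | m≤n⇒m⊓n≡m s<B = begin
    suc α ^ K * A ^ s        ≤⟨ *-monoˡ-≤ (A ^ s) ([1+α]^K≤K^K*2^α α) ⟩
    A * 2 ^ α * A ^ s        ≤⟨ *-monoˡ-≤ (A ^ s) (*-monoʳ-≤ A (^-monoˡ-≤ α 2≤s)) ⟩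
    A * s ^ α * A ^ s        ≡⟨ regroup A (s ^ α) (A ^ s) ⟩
    s ^ α * (A * A ^ s)      ∎
    where
    open ≤-Reasoning
    regroup : ∀ a x y → a * x * y ≡ x * (a * y)
    regroup = solve-∀
  ... | no  s≮B rewrite m≥n⇒m⊓n≡n (≮⇒≥ s≮B) | m≥n⇒m⊓n≡n (m≤n⇒m≤1+n (≮⇒≥ s≮B)) =
    *-monoˡ-≤ (A ^ B) ([1+α]^K≤y^α α (≮⇒≥ s≮B))

  τ^K≤ : ∀ s {b} → 0 < b → (∀ {r} → Prime r → r ∣ b → r < s) → τ b ^ K ≤ A ^ (s ⊓ B) * b
  τ^K≤ zero {b} 0<b small with m≤n⇒m<n∨m≡n 0<b
  ... | inj₂ refl = ≤-reflexive (^-zeroˡ K)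
  ... | inj₁ 1<b with prime-factor 1<b
  ...   | r , r-prime , r∣b = contradiction (small r-prime r∣b) λ ()
  τ^K≤ (suc s) {b} 0<b small with prime? s
  ... | no ¬s-prime = ≤-trans (τ^K≤ s 0<b small′) (*-monoˡ-≤ b (^-monoʳ-≤ A (⊓-monoˡ-≤ B (n≤1+n s))))
    where
    small′ : ∀ {r} → Prime r → r ∣ b → r < s
    small′ r-prime r∣b = ≤∧≢⇒< (≤-pred (small r-prime r∣b)) λ { refl → ¬s-prime r-prime }
  ... | yes s-prime with factor-out s-prime 0<b
  ...   | α , c , refl , s∤c = begin
    τ (s ^ α * c) ^ K                     ≤⟨ ^-monoˡ-≤ K (τ-q^α* s-prime α 0<c) ⟩
    (suc α * τ c) ^ K                     ≡⟨ ^-distrib-* (suc α) (τ c) K ⟩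
    suc α ^ K * τ c ^ K                   ≤⟨ *-monoʳ-≤ (suc α ^ K) (τ^K≤ s 0<c small′) ⟩
    suc α ^ K * (A ^ (s ⊓ B) * c)         ≡⟨ *-assoc (suc α ^ K) _ c ⟨
    suc α ^ K * A ^ (s ⊓ B) * c           ≤⟨ *-monoˡ-≤ c (weight-step α (1<p s-prime)) ⟩
    s ^ α * A ^ (suc s ⊓ B) * c           ≡⟨ regroup (s ^ α) (A ^ (suc s ⊓ B)) c ⟩
    A ^ (suc s ⊓ B) * (s ^ α * c)         ∎
    where
    open ≤-Reasoning
    0<c : 0 < c
    0<c = n≢0⇒n>0 λ { refl → >⇒≢ 0<b (*-zeroʳ (s ^ α)) }
    small′ : ∀ {r} → Prime r → r ∣ c → r < s
    small′ r-prime r∣c = ≤∧≢⇒< (≤-pred (small r-prime (∣-trans r∣c (n∣m*n (s ^ α)))))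
      λ { refl → s∤c r∣c }
    regroup : ∀ x a c → x * a * c ≡ a * (x * c)
    regroup = solve-∀

  divisor-bound : ∀ {b} → 0 < b → τ b ^ K ≤ (K ^ K) ^ (2 ^ K) * b
  divisor-bound {b} 0<b = ≤-trans (τ^K≤ (suc b) 0<b (λ _ r∣b → s≤s (∣⇒≤ {{>-nonZero 0<b}} r∣b)))
    (*-monoˡ-≤ b (^-monoʳ-≤ A (m⊓n≤n (suc b) B)))

τmax : ℕ → ℕ → ℕ
τmax n X = ⨆ X (λ b → τ (suc b) ^ n)

τ^n≤τmax : ∀ n {b X} → 0 < b → b ≤ X → τ b ^ n ≤ τmax n X
τ^n≤τmax n {suc b} {X} _ b<X = term≤⨆ X (λ b → τ (suc b) ^ n) b<X

τmax^m≤ : ∀ n m .{{_ : NonZero (n * m)}} → 0 < m → ∀ X → τmax n X ^ m ≤ ((n * m) ^ (n * m)) ^ (2 ^ (n * m)) * X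
τmax^m≤ n m 0<m X = ⨆^m≤ X (λ b → τ (suc b) ^ n) 0<m (λ {b} b<X → begin
  (τ (suc b) ^ n) ^ m          ≡⟨ ^-*-assoc (τ (suc b)) n m ⟩
  τ (suc b) ^ (n * m)          ≤⟨ divisor-bound (n * m) z<s ⟩
  C₀ * suc b                   ≤⟨ *-monoʳ-≤ C₀ b<X ⟩
  C₀ * X                       ∎)
  where
  open ≤-Reasoning
  C₀ = ((n * m) ^ (n * m)) ^ (2 ^ (n * m))

-- Sums over tuples

module _ (H : ℕ) where

  -- tupleSum n F = ∑ over (h₁, …, hₙ) ∈ {1, …, H}ⁿ of F (h₁ ⋯ hₙ).
  tupleSum : ℕ → (ℕ → ℕ) → ℕ
  tupleSum zero    F = F 1
  tupleSum (suc n) F = ∑ H (λ h → tupleSum n (λ a → F (suc h * a)))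

  tupleSum-mono-≤ : ∀ n {F G : ℕ → ℕ} → (∀ {a} → 0 < a → a ≤ H ^ n → F a ≤ G a) →
    tupleSum n F ≤ tupleSum n G
  tupleSum-mono-≤ zero    h = h z<s ≤-refl
  tupleSum-mono-≤ (suc n) h = ∑-mono-≤ H (λ {i} i<H → tupleSum-mono-≤ n (λ 0<a a≤ →
    h (*-mono-≤ (s≤s (z≤n {i})) 0<a) (*-mono-≤ i<H a≤)))

  tupleSum-cong : ∀ n {F G : ℕ → ℕ} → (∀ a → F a ≡ G a) → tupleSum n F ≡ tupleSum n G
  tupleSum-cong n h = ≤-antisym (tupleSum-mono-≤ n (λ {a} _ _ → ≤-reflexive (h a)))
                                (tupleSum-mono-≤ n (λ {a} _ _ → ≤-reflexive (sym (h a))))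

  *-distribˡ-tupleSum : ∀ n c (F : ℕ → ℕ) → c * tupleSum n F ≡ tupleSum n (λ a → c * F a)
  *-distribˡ-tupleSum zero    c F = refl
  *-distribˡ-tupleSum (suc n) c F =
    trans (*-distribˡ-∑ H c _) (∑-cong H (λ {i} _ → *-distribˡ-tupleSum n c (λ a → F (suc i * a))))

  tupleSum-∑-comm : ∀ n m (G : ℕ → ℕ → ℕ) → tupleSum n (λ a → ∑ m (λ j → G j a)) ≡ ∑ m (λ j → tupleSum n (G j))
  tupleSum-∑-comm zero    m G = refl
  tupleSum-∑-comm (suc n) m G =
    trans (∑-cong H (λ {i} _ → tupleSum-∑-comm n m (λ j a → G j (suc i * a))))
          (∑-comm H m (λ i j → tupleSum n (λ a → G j (suc i * a))))

  tupleSum-const : ∀ n c → tupleSum n (λ _ → c) ≡ H ^ n * c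
  tupleSum-const zero    c = sym (+-identityʳ c)
  tupleSum-const (suc n) c = trans (∑-cong H (λ _ → tupleSum-const n c))
                                   (trans (∑-const H (H ^ n * c)) (sym (*-assoc H (H ^ n) c)))

  tupleSum-product≡≤τ^n : ∀ n {b} → 0 < b → tupleSum n (λ c → ⟦ c ≡ᵇ b ⟧) ≤ τ b ^ n
  tupleSum-product≡≤τ^n zero    _   = ⟦⟧≤1 _
  tupleSum-product≡≤τ^n (suc n) {b} 0<b = begin
    ∑ H (λ h → tupleSum n (λ a → ⟦ suc h * a ≡ᵇ b ⟧))
      ≤⟨ ∑-mono-≤ H (λ {h} _ → first-factor h) ⟩
    ∑ H (λ h → ⟦ suc h ∣ᵇ b ⟧ * τ b ^ n)
      ≡⟨ *-distribʳ-∑ H (τ b ^ n) _ ⟨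
    countBelow H (λ h → suc h ∣ᵇ b) * τ b ^ n
      ≤⟨ *-monoˡ-≤ (τ b ^ n) (countBelow-divisors≤τ H 0<b) ⟩
    τ b * τ b ^ n                                    ∎
    where
    open ≤-Reasoning
    first-factor : ∀ h → tupleSum n (λ a → ⟦ suc h * a ≡ᵇ b ⟧) ≤ ⟦ suc h ∣ᵇ b ⟧ * τ b ^ n
    first-factor h with T? (suc h ∣ᵇ b)
    ... | no h+1∤b = begin
      tupleSum n (λ a → ⟦ suc h * a ≡ᵇ b ⟧)
        ≤⟨ tupleSum-mono-≤ n (λ {a} _ _ → ≤-reflexive (¬T⇒⟦⟧≡0 (no-solution a))) ⟩
      tupleSum n (λ _ → 0)
        ≡⟨ trans (tupleSum-const n 0) (*-zeroʳ (H ^ n)) ⟩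
      0
        ≤⟨ z≤n ⟩
      ⟦ suc h ∣ᵇ b ⟧ * τ b ^ n             ∎
      where
      no-solution : ∀ a → ¬ T (suc h * a ≡ᵇ b)
      no-solution a eq = h+1∤b (∣⇒∣ᵇ (divides a (trans (sym (≡ᵇ⇒≡ _ b eq)) (*-comm (suc h) a))))
    ... | yes h+1∣b with ∣ᵇ⇒∣ h+1∣b
    ...   | divides b′ b≡b′[h+1] = begin
      tupleSum n (λ a → ⟦ suc h * a ≡ᵇ b ⟧) ≤⟨ tupleSum-mono-≤ n (λ {a} _ _ → ⟦⟧-mono (cancel a)) ⟩
      tupleSum n (λ a → ⟦ a ≡ᵇ b′ ⟧)        ≤⟨ tupleSum-product≡≤τ^n n 0<b′ ⟩
      τ b′ ^ n                             ≤⟨ ^-monoˡ-≤ n (τ-mono-∣ 0<b (divides (suc h) b≡[h+1]b′)) ⟩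
      τ b ^ n                              ≡⟨ +-identityʳ _ ⟨
      1 * τ b ^ n                          ≡⟨ cong (_* τ b ^ n) (T⇒⟦⟧≡1 h+1∣b) ⟨
      ⟦ suc h ∣ᵇ b ⟧ * τ b ^ n             ∎
      where
      b≡[h+1]b′ : b ≡ suc h * b′
      b≡[h+1]b′ = trans b≡b′[h+1] (*-comm b′ (suc h))
      0<b′ : 0 < b′
      0<b′ = n≢0⇒n>0 λ { refl → >⇒≢ 0<b b≡b′[h+1] }
      cancel : ∀ a → T (suc h * a ≡ᵇ b) → T (a ≡ᵇ b′)
      cancel a eq = ≡⇒≡ᵇ a b′ (*-cancelˡ-≡ a b′ (suc h) (trans (≡ᵇ⇒≡ _ b eq) b≡[h+1]b′))

  tupleSum≤M*∑ : ∀ n M (F : ℕ → ℕ) → (∀ {b} → 0 < b → b ≤ H ^ n → tupleSum n (λ c → ⟦ c ≡ᵇ b ⟧) ≤ M) →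
    tupleSum n F ≤ M * ∑ (H ^ n) (F ∘ suc)
  tupleSum≤M*∑ n M F multiplicity = begin
    tupleSum n F
      ≤⟨ tupleSum-mono-≤ n split ⟩
    tupleSum n (λ c → ∑ X (λ b → F (suc b) * ⟦ c ≡ᵇ suc b ⟧))
      ≡⟨ tupleSum-∑-comm n X _ ⟩
    ∑ X (λ b → tupleSum n (λ c → F (suc b) * ⟦ c ≡ᵇ suc b ⟧))
      ≡⟨ ∑-cong X (λ {b} _ → *-distribˡ-tupleSum n (F (suc b)) _) ⟨
    ∑ X (λ b → F (suc b) * tupleSum n (λ c → ⟦ c ≡ᵇ suc b ⟧))
      ≤⟨ ∑-mono-≤ X (λ {b} b<X → *-monoʳ-≤ (F (suc b)) (multiplicity z<s b<X)) ⟩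
    ∑ X (λ b → F (suc b) * M)
      ≡⟨ *-distribʳ-∑ X M (F ∘ suc) ⟨
    ∑ X (F ∘ suc) * M
      ≡⟨ *-comm _ M ⟩
    M * ∑ X (F ∘ suc)                                       ∎
    where
    open ≤-Reasoning
    X = H ^ n
    split : ∀ {c} → 0 < c → c ≤ X → F c ≤ ∑ X (λ b → F (suc b) * ⟦ c ≡ᵇ suc b ⟧)
    split {suc c} _ c<X =
      ≤-trans (≤-reflexive (sym (trans (cong (F (suc c) *_) (T⇒⟦⟧≡1 (≡⇒≡ᵇ c c refl))) (*-identityʳ _))))
                                   (term≤∑ X (λ b → F (suc b) * ⟦ suc c ≡ᵇ suc b ⟧) c<X)

J≡∑∑ : ∀ p e H → J p e H ≡ ∑ H (λ i → ∑ H (λ j → ⟦ ratioIsResidue p e (suc i) (suc j) ⟧))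
J≡∑∑ p e H = trans (sum-map-range1 H _) (∑-cong H (λ _ → sum-map-range1 H _))

module _ {p : ℕ} (p-prime : Prime p) (e H : ℕ) where
  private instance _ = prime⇒nonZero p-prime

  χ : ℕ → ℕ → ℕ
  χ a b = ⟦ ratioIsResidue p e a b ⟧

  J^n≤tupleSum : ∀ n → J p e H ^ n ≤ tupleSum H n (λ a → tupleSum H n (χ a))
  J^n≤tupleSum zero = ≤-reflexive (sym (T⇒⟦⟧≡1 (ratioIsResidue⁺ z<s (1<p p-prime)
    (cong (_% p) (trans (*-identityˡ (1 ^ e)) (^-zeroˡ e))))))
  J^n≤tupleSum (suc n) = begin
    J p e H * J p e H ^ n
      ≤⟨ *-monoʳ-≤ (J p e H) (J^n≤tupleSum n) ⟩
    J p e H * W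
      ≡⟨ cong (_* W) (J≡∑∑ p e H) ⟩
    ∑ H (λ i → ∑ H (λ j → χ (suc i) (suc j))) * W
      ≡⟨ trans (*-distribʳ-∑ H W _) (∑-cong H (λ _ → *-distribʳ-∑ H W _)) ⟩
    ∑ H (λ i → ∑ H (λ j → χ (suc i) (suc j) * W))
      ≤⟨ ∑-mono-≤ H (λ {i} _ → ∑-mono-≤ H (λ {j} _ → shift i j)) ⟩
    ∑ H (λ i → ∑ H (λ j → tupleSum H n (λ a → tupleSum H n (χ′ i j a))))
      ≡⟨ ∑-cong H (λ {i} _ → tupleSum-∑-comm H n H (λ j a → tupleSum H n (χ′ i j a))) ⟨
    tupleSum H (suc n) (λ a → tupleSum H (suc n) (χ a))
      ∎
    where
    open ≤-Reasoning
    W = tupleSum H n (λ a → tupleSum H n (χ a))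
    χ′ : ℕ → ℕ → ℕ → ℕ → ℕ
    χ′ i j a b = χ (suc i * a) (suc j * b)
    shift : ∀ i j → χ (suc i) (suc j) * W ≤ tupleSum H n (λ a → tupleSum H n (χ′ i j a))
    shift i j = begin
      c * W
        ≡⟨ *-distribˡ-tupleSum H n c _ ⟩
      tupleSum H n (λ a → c * tupleSum H n (χ a))
        ≡⟨ tupleSum-cong H n (λ a → *-distribˡ-tupleSum H n c _) ⟩
      tupleSum H n (λ a → tupleSum H n (λ b → c * χ a b))
        ≤⟨ tupleSum-mono-≤ H n (λ _ _ → tupleSum-mono-≤ H n (λ _ _ → ⟦⟧*⟦⟧≤⟦⟧ (ratioIsResidue-* p-prime))) ⟩
      tupleSum H n (λ a → tupleSum H n (χ′ i j a))
        ∎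
      where c = χ (suc i) (suc j)

  J^n≤ : ∀ {t} → 0 < t → e * t ≡ p ∸ 1 → ∀ n → J p e H ^ n ≤ H ^ n * (τmax n (H ^ n) * (t * (H ^ n / p + 1)))
  J^n≤ {t} 0<t et≡p-1 n = begin
    J p e H ^ n
      ≤⟨ J^n≤tupleSum n ⟩
    tupleSum H n (λ a → tupleSum H n (χ a))
      ≤⟨ tupleSum-mono-≤ H n (λ {a} _ _ → tupleSum≤M*∑ H n M (χ a) multiplicity) ⟩
    tupleSum H n (λ a → M * ∑ X (χ a ∘ suc))
      ≤⟨ tupleSum-mono-≤ H n (λ {a} _ _ → *-monoʳ-≤ M (countBelow-ratioIsResidue p-prime 0<t et≡p-1 a X)) ⟩
    tupleSum H n (λ _ → M * (t * (X / p + 1)))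
      ≡⟨ tupleSum-const H n _ ⟩
    X * (M * (t * (X / p + 1)))
      ∎
    where
    open ≤-Reasoning
    X = H ^ n
    M = τmax n X
    multiplicity : ∀ {b} → 0 < b → b ≤ X → tupleSum H n (λ c → ⟦ c ≡ᵇ b ⟧) ≤ M
    multiplicity 0<b b≤X = ≤-trans (tupleSum-product≡≤τ^n H n 0<b) (τ^n≤τmax n 0<b b≤X)

  J^n*e≤ : ∀ {t} → e * t ≡ p ∸ 1 → ∀ n → J p e H ^ n * e ≤ H ^ n * τmax n (H ^ n) * (2 * (H ^ n ⊔ p))
  J^n*e≤ {t} et≡p-1 n = begin
    J p e H ^ n * e                         ≤⟨ *-monoˡ-≤ e (J^n≤ 0<t et≡p-1 n) ⟩
    X * (M * (t * (X / p + 1))) * e         ≡⟨ regroup X M t (X / p + 1) e ⟩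
    X * M * ((e * t) * (X / p + 1))         ≡⟨ cong (λ k → X * M * (k * (X / p + 1))) et≡p-1 ⟩
    X * M * ((p ∸ 1) * (X / p + 1))         ≤⟨ *-monoʳ-≤ (X * M) ([n∸1]*[m/n+1]≤m+n X p) ⟩
    X * M * (X + p)                         ≤⟨ *-monoʳ-≤ (X * M) (+-mono-≤ (m≤m⊔n X p) (m≤n⊔m X p)) ⟩
    X * M * ((X ⊔ p) + (X ⊔ p))             ≡⟨ cong (λ y → X * M * ((X ⊔ p) + y)) (+-identityʳ (X ⊔ p)) ⟨
    X * M * (2 * (X ⊔ p))                   ∎
    where
    open ≤-Reasoning
    X = H ^ n
    M = τmax n X
    regroup : ∀ x M t y e → x * (M * (t * y)) * e ≡ x * M * ((e * t) * y)
    regroup = solve-∀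
    0<t : 0 < t
    0<t = n≢0⇒n>0 λ { refl → >⇒≢ (∸-monoˡ-< (1<p p-prime) ≤-refl) (trans (sym et≡p-1) (*-zeroʳ e)) }

  J^[m*n]*e^m≤ : ∀ {t} → e * t ≡ p ∸ 1 → ∀ n m →
    J p e H ^ (m * n) * e ^ m ≤ 2 ^ m * τmax n (H ^ n) ^ m * H ^ (m * n) * (H ^ n ⊔ p) ^ m
  J^[m*n]*e^m≤ et≡p-1 n m = begin
    J p e H ^ (m * n) * e ^ m
      ≡⟨ cong (_* e ^ m) (x^[m*n] (J p e H)) ⟩
    (J p e H ^ n) ^ m * e ^ m
      ≡⟨ ^-distrib-* (J p e H ^ n) e m ⟨
    (J p e H ^ n * e) ^ m
      ≤⟨ ^-monoˡ-≤ m (J^n*e≤ et≡p-1 n) ⟩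
    (H ^ n * M * (2 * Y)) ^ m
      ≡⟨ trans (^-distrib-* _ (2 * Y) m) (cong₂ _*_ (^-distrib-* (H ^ n) M m) (^-distrib-* 2 Y m)) ⟩
    (H ^ n) ^ m * M ^ m * (2 ^ m * Y ^ m)
      ≡⟨ rearrange ((H ^ n) ^ m) (M ^ m) (2 ^ m) (Y ^ m) ⟩
    2 ^ m * M ^ m * (H ^ n) ^ m * Y ^ m
      ≡⟨ cong (λ x → 2 ^ m * M ^ m * x * Y ^ m) (x^[m*n] H) ⟨
    2 ^ m * M ^ m * H ^ (m * n) * Y ^ m        ∎
    where
    open ≤-Reasoning
    Y = H ^ n ⊔ p
    M = τmax n (H ^ n)
    x^[m*n] : ∀ x → x ^ (m * n) ≡ (x ^ n) ^ m
    x^[m*n] x = trans (cong (x ^_) (*-comm m n)) (sym (^-*-assoc x n m))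
    rearrange : ∀ x c t y → x * c * (t * y) ≡ t * c * x * y
    rearrange = solve-∀

lemma3p3 : (n : ℕ) → 1 ≤ n → (m : ℕ) → 1 ≤ m →
    ∃ λ (C : ℕ) → (p e H : ℕ) → Prime p → 1 ≤ e → e ∣ p ∸ 1 →
    1 ≤ H → H < p →
    J p e H ^ (m * n) * e ^ m ≤ C * p ^ n * H ^ (m * n) * (H ^ n ⊔ p) ^ m
lemma3p3 n 1≤n m 1≤m = 2 ^ m * C₀ , bound
  where
  instance _ = >-nonZero (*-mono-≤ 1≤n 1≤m)
  C₀ = ((n * m) ^ (n * m)) ^ (2 ^ (n * m))
  bound : (p e H : ℕ) → Prime p → 1 ≤ e → e ∣ p ∸ 1 → 1 ≤ H → H < p →
    J p e H ^ (m * n) * e ^ m ≤ 2 ^ m * C₀ * p ^ n * H ^ (m * n) * (H ^ n ⊔ p) ^ m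
  bound p e H p-prime _ (divides t p-1≡te) _ H<p = begin
    J p e H ^ (m * n) * e ^ m
      ≤⟨ J^[m*n]*e^m≤ p-prime e H (trans (*-comm e t) (sym p-1≡te)) n m ⟩
    2 ^ m * M ^ m * H ^ (m * n) * Y ^ m
      ≤⟨ *-monoˡ-≤ (Y ^ m) (*-monoˡ-≤ (H ^ (m * n)) (*-monoʳ-≤ (2 ^ m) M^m≤)) ⟩
    2 ^ m * (C₀ * p ^ n) * H ^ (m * n) * Y ^ m
      ≡⟨ cong (λ x → x * H ^ (m * n) * Y ^ m) (*-assoc (2 ^ m) C₀ (p ^ n)) ⟨
    2 ^ m * C₀ * p ^ n * H ^ (m * n) * Y ^ m    ∎
    where
    open ≤-Reasoning
    Y = H ^ n ⊔ p
    M = τmax n (H ^ n)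
    M^m≤ : M ^ m ≤ C₀ * p ^ n
    M^m≤ = ≤-trans (τmax^m≤ n m 1≤m (H ^ n)) (*-monoʳ-≤ C₀ (^-monoˡ-≤ n (<⇒≤ H<p)))
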